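{- Let $n\ge1$ and let $D=(d_1,\dots,d_k)$ be a sequence of integers. Then $D$ is the vertex-order lower degree sequence $D_2(\pi)$ for some partition $\pi$ of $[n]$ if and only if (1) $d_1=0$ and $d_2,\dots,d_k\ge0$; (2) $d_{i+1}\le d_i+1$ for every $i\in[k-1]$; and (3) $n\ge k+|A(D)|$, where $A(D)=\{i\in[k-1]: d_{i+1}>d_i\}$ is the set of ascents of $D$.
   Context: For a partition $\pi$ of $[n]$ with blocks $X_1,\dots,X_k$ indexed so that $\min X_1<\cdots<\min X_k$, blocks $X_i,X_j$ overlap if neither $\max X_i<\min X_j$ nor $\max X_j<\min X_i$. The lower degree $d_i(\pi)$ is the number of $j<i$ such that $X_j$ overlaps $X_i$. The vertex-order lower degree sequence is $D_2(\pi)=(d_1(\pi),\dots,d_k(\pi))$ (so its length is the number of blocks). -}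

module Defs where

open import Data.Nat using (ℕ; _<_; _<ᵇ_)
open import Data.Bool using (Bool; true; false; _∧_; not; T)
open import Data.Fin using (Fin; toℕ)
import Data.Fin as Fin
open import Data.Fin.Properties using (_≟_)
open import Data.List using (List; _∷_; []; filter; length; allFin; map; zip; drop; filterᵇ)
open import Data.Bool.ListAction using (and)
open import Data.Integer using (ℤ; +_)
import Data.Integer.Properties as ℤP
open import Data.Product using (Σ; ∃; _×_; _,_; proj₁; proj₂)
open import Relation.Binary.PropositionalEquality using (_≡_)
open import Relation.Nullary using (does)

-- A partition of [n] = {0,…,n-1} into k blocks X_0,…,X_{k-1} (0-indexed),
-- given by the block label of each element: every block is nonempty, and
-- blocks are indexed so that min X_i < min X_j whenever i < j
-- (stated as: every element of X_j is preceded by some element of X_i).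
record Partition (n k : ℕ) : Set where
  field
    label    : Fin n → Fin k
    nonempty : ∀ (i : Fin k) → ∃ λ x → label x ≡ i
    minOrder : ∀ (i j : Fin k) → toℕ i < toℕ j →
               ∀ (y : Fin n) → label y ≡ j →
               ∃ λ x → label x ≡ i × toℕ x < toℕ y
open Partition public

module _ {n k : ℕ} (π : Partition n k) where

  block : Fin k → List (Fin n)
  block i = filter (λ x → label π x ≟ i) (allFin n)

  -- max X_i < min X_j  (every element of X_i is below every element of X_j;
  -- blocks are nonempty)
  maxBelowMin : Fin k → Fin k → Bool
  maxBelowMin i j = and (map (λ x → and (map (λ y → toℕ x <ᵇ toℕ y) (block j))) (block i))

  overlaps : Fin k → Fin k → Bool
  overlaps i j = not (maxBelowMin i j) ∧ not (maxBelowMin j i)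

  lowerDegree : Fin k → ℕ
  lowerDegree i = length (filterᵇ (λ j → (toℕ j <ᵇ toℕ i) ∧ overlaps j i) (allFin k))

  D₂ : List ℤ
  D₂ = map (λ i → + lowerDegree i) (allFin k)

ascentCount : List ℤ → ℕ
ascentCount D = length (filter (λ p → proj₁ p ℤP.<? proj₂ p) (zip D (drop 1 D)))

-- Necessity. If X_j overlaps X_{i+1} and j < i, then X_j also overlaps X_i, since
-- min X_i < min X_{i+1}.  Hence d_{i+1} ≤ d_i + [X_i overlaps X_{i+1}], and at an ascent
-- X_i overlaps a later block, so it has at least two elements; summing the block sizes
-- gives n ≥ k + |A(D)|.
--
-- Sufficiency. Let a_i be the number of ascents before i and e_i = a_i − d_i, which is
-- nondecreasing by (2).  Open block i at position i + e_i.  Give each ascent block j one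
-- more element, placed right after the second elements of the a_j earlier ascent blocks and
-- after the openings of the blocks i with e_i ≤ a_j; every remaining position joins the
-- block opened last.  Then a block X_j overlaps a later X_i exactly when j is an ascent
-- with e_i ≤ a_j, and the ascents j < i with a_j ≥ e_i number a_i − e_i = d_i.
module Submission where

open import Data.Bool using (Bool; true; false; _∧_; not; T; T?)
open import Data.Bool.ListAction using (all)
open import Data.Bool.Properties using (T-≡; T-∧)
open import Data.Fin using (Fin; zero; suc; toℕ; inject₁; fromℕ<)
open import Data.Fin.Properties using (toℕ-injective; toℕ-inject₁; toℕ-fromℕ<; toℕ<n; any?)
  renaming (_≟_ to _≟ᶠ_)
open import Data.Integer using (ℤ; +_; -[1+_]; +≤+; +<+; ∣_∣)
  renaming (_≤_ to _≤ℤ_; _<_ to _<ℤ_; _+_ to _+ℤ_)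
open import Data.Integer.Properties using (drop‿+≤+) renaming (_<?_ to _<ℤ?_)
open import Data.List using (List; []; _∷_; length; filter; tabulate; allFin; lookup)
open import Data.List.Membership.Propositional using (_∈_; find)
open import Data.List.Membership.Propositional.Properties using (∈-filter⁺; ∈-filter⁻; ∈-allFin; ∈-length)
open import Data.List.Properties using (map-tabulate; length-tabulate; tabulate-cong; tabulate-lookup)
open import Data.List.Relation.Unary.All as All using (All; _∷_)
open import Data.List.Relation.Unary.All.Properties using (all⁺; all⁻; ¬All⇒Any¬; tabulate⁺)
open import Data.List.Relation.Unary.Any using (here)
open import Data.List.Relation.Unary.Linked using (Linked; [-]; _∷_)
open import Data.Nat
open import Data.Nat.Properties
open import Data.Product using (_×_; _,_; proj₁; proj₂; ∃; ∃₂)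
open import Data.Sum using (_⊎_; inj₁; inj₂)
open import Defs
open import Function using (_∘_; id)
open import Function.Bundles using (Equivalence; _⇔_; mk⇔)
open import Relation.Binary.Definitions using (tri<; tri≈; tri>)
open import Relation.Binary.PropositionalEquality
open import Relation.Nullary using (¬_; Dec; does; yes; no; contradiction)
open import Relation.Nullary.Decidable using (dec-true; _×-dec_)
open import Relation.Nullary.Reflects using (ofʸ; ofⁿ)
open import Relation.Unary using (Pred; Decidable)

open import Algebra.Properties.CommutativeMonoid.Sum +-0-commutativeMonoid
  using (sum-syntax; ∑-distrib-+; ∑-comm; sum-cong-≗; sum-replicate-zero)

𝟙 : Bool → ℕ
𝟙 true  = 1
𝟙 false = 0

𝟙≤1 : ∀ b → 𝟙 b ≤ 1
𝟙≤1 true  = ≤-refl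
𝟙≤1 false = z≤n

𝟙-true : ∀ {b} → T b → 𝟙 b ≡ 1
𝟙-true {true} _ = refl

𝟙-false : ∀ {b} → ¬ T b → 𝟙 b ≡ 0
𝟙-false {false} _  = refl
𝟙-false {true}  ¬b = contradiction _ ¬b

𝟙-mono : ∀ {a b} → (T a → T b) → 𝟙 a ≤ 𝟙 b
𝟙-mono {false} _ = z≤n
𝟙-mono {true}  f = ≤-reflexive (sym (𝟙-true (f _)))

𝟙-≤-+ : ∀ {a b c} → (T a → T b ⊎ T c) → 𝟙 a ≤ 𝟙 b + 𝟙 c
𝟙-≤-+ {false}         _ = z≤n
𝟙-≤-+ {true} {b} {c} h with h _
... | inj₁ tb = ≤-trans (≤-reflexive (sym (𝟙-true tb))) (m≤m+n (𝟙 b) (𝟙 c))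
... | inj₂ tc = ≤-trans (≤-reflexive (sym (𝟙-true tc))) (m≤n+m (𝟙 c) (𝟙 b))

¬T⇒≡false : ∀ {b} → ¬ T b → b ≡ false
¬T⇒≡false {false} _  = refl
¬T⇒≡false {true}  ¬b = contradiction _ ¬b

T-ext : ∀ {a b} → (T a → T b) → (T b → T a) → a ≡ b
T-ext {false} {false} _ _ = refl
T-ext {false} {true}  _ g = contradiction (g _) λ ()
T-ext {true}  {false} f _ = contradiction (f _) λ ()
T-ext {true}  {true}  _ _ = refl

T-nor⁺ : ∀ {a b} → ¬ T a → ¬ T b → T (not a ∧ not b)
T-nor⁺ {false} {false} _  _  = _
T-nor⁺ {false} {true}  _  ¬b = ¬b _
T-nor⁺ {true}          ¬a _  = ¬a _

T-nor⁻ : ∀ {a b} → T (not a ∧ not b) → ¬ T a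
T-nor⁻ {false} _ ()

¬all⇒∃ : ∀ {A : Set} (p : A → Bool) xs → ¬ T (all p xs) → ∃ λ x → x ∈ xs × ¬ T (p x)
¬all⇒∃ p xs ¬all = find (¬All⇒Any¬ (T? ∘ p) xs (¬all ∘ all⁻ p))

-- Counting

count : (ℕ → Bool) → ℕ → ℕ
count b zero    = 0
count b (suc m) = count b m + 𝟙 (b m)

module _ (b : ℕ → Bool) where

  count-suc : ∀ m → count b (suc m) ≡ 𝟙 (b 0) + count (b ∘ suc) m
  count-suc zero    = +-comm 0 (𝟙 (b 0))
  count-suc (suc m) = trans (cong (_+ 𝟙 (b (suc m))) (count-suc m)) (+-assoc (𝟙 (b 0)) _ _)

  count≤ : ∀ m → count b m ≤ m
  count≤ zero    = z≤n
  count≤ (suc m) = ≤-trans (+-mono-≤ (count≤ m) (𝟙≤1 (b m))) (≤-reflexive (+-comm m 1))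

  count-monoʳ : ∀ {m m'} → m ≤ m' → count b m ≤ count b m'
  count-monoʳ {m' = zero}  z≤n = ≤-refl
  count-monoʳ {m} {suc m'} m≤ with m ≟ suc m'
  ... | yes refl = ≤-refl
  ... | no m≢    = ≤-trans (count-monoʳ (s≤s⁻¹ (≤∧≢⇒< m≤ m≢))) (m≤m+n _ _)

  count-all : ∀ m → (∀ j → j < m → T (b j)) → count b m ≡ m
  count-all zero    _ = refl
  count-all (suc m) h =
    trans (cong₂ _+_ (count-all m (λ j j<m → h j (m<n⇒m<1+n j<m))) (𝟙-true (h m ≤-refl))) (+-comm m 1)

count-mono : ∀ {b b'} m → (∀ j → j < m → T (b j) → T (b' j)) → count b m ≤ count b' m
count-mono zero    _ = z≤n
count-mono (suc m) h = +-mono-≤ (count-mono m (λ j j<m → h j (m<n⇒m<1+n j<m))) (𝟙-mono (h m ≤-refl))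

count-cong : ∀ {b b'} m → (∀ j → j < m → b j ≡ b' j) → count b m ≡ count b' m
count-cong zero    _ = refl
count-cong (suc m) h = cong₂ _+_ (count-cong m (λ j j<m → h j (m<n⇒m<1+n j<m))) (cong 𝟙 (h m ≤-refl))

count-below : ∀ b {t m} → t ≤ m → count (λ j → (j <ᵇ t) ∧ b j) m ≡ count b t
count-below b {t} {zero}  z≤n = refl
count-below b {t} {suc m} t≤ with t ≟ suc m
... | yes refl = count-cong (suc m) (λ j j<t → cong (_∧ b j) (Equivalence.to T-≡ (<⇒<ᵇ j<t)))
... | no t≢    = trans (cong₂ _+_ (count-below b t≤m) (cong (λ c → 𝟙 (c ∧ b m)) m≮ᵇt)) (+-identityʳ _)
  where
  t≤m = s≤s⁻¹ (≤∧≢⇒< t≤ t≢)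
  m≮ᵇt = ¬T⇒≡false (λ m<ᵇt → <⇒≱ (<ᵇ⇒< m t m<ᵇt) t≤m)

-- At the successive j < m with b j, count b j runs through 0, 1, …, count b m ∸ 1.
count-∧-≤ᵇ-count : ∀ b t m → count (λ j → b j ∧ (t ≤ᵇ count b j)) m ≡ count b m ∸ t
count-∧-≤ᵇ-count b t zero    = sym (0∸n≡0 t)
count-∧-≤ᵇ-count b t (suc m) rewrite count-∧-≤ᵇ-count b t m
  with b m | t ≤ᵇ count b m | ≤ᵇ-reflects-≤ t (count b m)
... | false | _     | _       = trans (+-identityʳ _) (cong (_∸ t) (sym (+-identityʳ (count b m))))
... | true  | true  | ofʸ t≤c = sym (+-∸-comm 1 t≤c)
... | true  | false | ofⁿ t≰c = trans (+-identityʳ _) (trans (m≤n⇒m∸n≡0 (<⇒≤ c<t)) (sym (m≤n⇒m∸n≡0 c+1≤t)))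
  where
  c<t = ≰⇒> t≰c
  c+1≤t = ≤-trans (≤-reflexive (+-comm (count b m) 1)) c<t

DownClosedBelow : ℕ → (ℕ → Bool) → Set
DownClosedBelow k b = ∀ {i j} → i ≤ j → j < k → T (b j) → T (b i)

<count-trueAt : ∀ {b k} → DownClosedBelow k b → ∀ {i} → i < k → T (b i) → i < count b k
<count-trueAt {b} down {i} i<k bi =
  ≤-trans (≤-reflexive (sym (count-all b (suc i) (λ j j≤i → down (s≤s⁻¹ j≤i) i<k bi)))) (count-monoʳ b i<k)

count≤-falseAt : ∀ {b} k → DownClosedBelow k b → ∀ {i} → i < k → ¬ T (b i) → count b k ≤ i
count≤-falseAt {b} (suc m) down {i} i<1+m ¬bi =
  ≤-trans (≤-reflexive (trans (cong (_+_ (count b m)) (𝟙-false ¬bm)) (+-identityʳ _))) count-m≤i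
  where
  ¬bm = ¬bi ∘ down (s≤s⁻¹ i<1+m) ≤-refl
  count-m≤i : count b m ≤ i
  count-m≤i with i ≟ m
  ... | yes refl = count≤ b m
  ... | no i≢m   = count≤-falseAt m (λ i≤j j<m → down i≤j (m<n⇒m<1+n j<m)) (≤∧≢⇒< (s≤s⁻¹ i<1+m) i≢m) ¬bi

∑-1 : ∀ n → ∑[ i < n ] 1 ≡ n
∑-1 zero    = refl
∑-1 (suc n) = cong suc (∑-1 n)

∑-mono : ∀ {k} {f g : Fin k → ℕ} → (∀ i → f i ≤ g i) → ∑[ i < k ] f i ≤ ∑[ i < k ] g i
∑-mono {zero}  _ = z≤n
∑-mono {suc k} h = +-mono-≤ (h zero) (∑-mono (h ∘ suc))

∑-𝟙-toℕ : ∀ b k → ∑[ i < k ] 𝟙 (b (toℕ i)) ≡ count b k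
∑-𝟙-toℕ b zero    = refl
∑-𝟙-toℕ b (suc k) = trans (cong (_+_ (𝟙 (b 0))) (∑-𝟙-toℕ (b ∘ suc) k)) (sym (count-suc b k))

∑-𝟙-∧-≟ : ∀ {k} b (c : Fin k) → ∑[ i < k ] 𝟙 (b ∧ does (c ≟ᶠ i)) ≡ 𝟙 b
∑-𝟙-∧-≟ {k}     false _       = sum-replicate-zero k
∑-𝟙-∧-≟ {suc k} true  zero    = cong suc (sum-replicate-zero k)
∑-𝟙-∧-≟ {suc k} true  (suc c) = ∑-𝟙-∧-≟ true c

length-filter-tabulate : ∀ {a p} {A : Set a} {P : Pred A p} (P? : Decidable P) {k} (f : Fin k → A) →
                         length (filter P? (tabulate f)) ≡ ∑[ j < k ] 𝟙 (does (P? (f j)))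
length-filter-tabulate P? {zero}  f = refl
length-filter-tabulate P? {suc k} f with does (P? (f zero))
... | true  = cong suc (length-filter-tabulate P? (f ∘ suc))
... | false = length-filter-tabulate P? (f ∘ suc)

-- Blocks of a partition

length≥2 : ∀ {A : Set} {x y : A} {xs} → x ∈ xs → y ∈ xs → x ≢ y → 2 ≤ length xs
length≥2 {xs = _ ∷ _ ∷ _} _          _          _   = s≤s (s≤s z≤n)
length≥2 {xs = _ ∷ []}   (here refl) (here refl) x≢y = contradiction refl x≢y

module _ {n k} (π : Partition n k) where

  ∈-block⁺ : ∀ {i x} → label π x ≡ i → x ∈ block π i
  ∈-block⁺ {i} {x} = ∈-filter⁺ (λ y → label π y ≟ᶠ i) (∈-allFin x)

  ∈-block⁻ : ∀ {i x} → x ∈ block π i → label π x ≡ i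
  ∈-block⁻ {i} = proj₂ ∘ ∈-filter⁻ (λ y → label π y ≟ᶠ i) {xs = allFin n}

  maxBelowMin-false⁺ : ∀ {u v x y} → label π x ≡ u → label π y ≡ v → toℕ y ≤ toℕ x →
                       ¬ T (maxBelowMin π u v)
  maxBelowMin-false⁺ {x = x} {y} x∈u y∈v y≤x below = <⇒≱ (<ᵇ⇒< (toℕ x) (toℕ y) x<ᵇy) y≤x
    where
    x<ᵇy = All.lookup (all⁺ _ _ (All.lookup (all⁺ _ _ below) (∈-block⁺ x∈u))) (∈-block⁺ y∈v)

  maxBelowMin-false⁻ : ∀ {u v} → ¬ T (maxBelowMin π u v) →
                       ∃₂ λ x y → label π x ≡ u × label π y ≡ v × toℕ y ≤ toℕ x
  maxBelowMin-false⁻ {u} {v} ¬below with ¬all⇒∃ _ (block π u) ¬below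
  ... | x , x∈u , ¬x-below with ¬all⇒∃ _ (block π v) ¬x-below
  ... | y , y∈v , ¬x<y = x , y , ∈-block⁻ x∈u , ∈-block⁻ y∈v , ≮⇒≥ (¬x<y ∘ <⇒<ᵇ)

  overlaps⁺ : ∀ {j i x y} → toℕ j < toℕ i → label π x ≡ j → label π y ≡ i → toℕ y < toℕ x →
              T (overlaps π j i)
  overlaps⁺ j<i x∈j y∈i y<x with minOrder π _ _ j<i _ y∈i
  ... | x' , x'∈j , x'<y =
    T-nor⁺ (maxBelowMin-false⁺ x∈j y∈i (<⇒≤ y<x)) (maxBelowMin-false⁺ y∈i x'∈j (<⇒≤ x'<y))

  overlaps⁻ : ∀ {j i} → toℕ j < toℕ i → T (overlaps π j i) →
              ∃₂ λ x y → label π x ≡ j × label π y ≡ i × toℕ y < toℕ x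
  overlaps⁻ j<i ov with maxBelowMin-false⁻ (T-nor⁻ ov)
  ... | x , y , x∈j , y∈i , y≤x = x , y , x∈j , y∈i , ≤∧≢⇒< y≤x y≢x
    where
    y≢x : toℕ y ≢ toℕ x
    y≢x y≡x = <⇒≢ j<i (cong toℕ (trans (sym x∈j) (trans (cong (label π) (toℕ-injective (sym y≡x))) y∈i)))

  overlaps-downward : ∀ {j i i'} → toℕ j < toℕ i → toℕ i < toℕ i' → T (overlaps π j i') → T (overlaps π j i)
  overlaps-downward j<i i<i' ov with overlaps⁻ (<-trans j<i i<i') ov
  ... | x , y , x∈j , y∈i' , y<x with minOrder π _ _ i<i' y y∈i'
  ... | y' , y'∈i , y'<y = overlaps⁺ j<i x∈j y'∈i (<-trans y'<y y<x)

  1≤|block| : ∀ i → 1 ≤ length (block π i)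
  1≤|block| i = ∈-length (∈-block⁺ (proj₂ (nonempty π i)))

  overlaps⇒2≤|block| : ∀ {j i} → toℕ j < toℕ i → T (overlaps π j i) → 2 ≤ length (block π j)
  overlaps⇒2≤|block| j<i ov with overlaps⁻ j<i ov
  ... | x , y , x∈j , y∈i , y<x with minOrder π _ _ j<i y y∈i
  ... | x' , x'∈j , x'<y =
    length≥2 (∈-block⁺ x∈j) (∈-block⁺ x'∈j) (λ x≡x' → <-irrefl (cong toℕ (sym x≡x')) (<-trans x'<y y<x))

  ∑|block|≡n : ∑[ i < k ] length (block π i) ≡ n
  ∑|block|≡n = begin
    ∑[ i < k ] length (block π i)  ≡⟨ sum-cong-≗ (λ i → length-filter-tabulate (λ x → label π x ≟ᶠ i) id) ⟩
    ∑[ i < k ] ∑[ x < n ] δ i x    ≡⟨ ∑-comm δ ⟩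
    ∑[ x < n ] ∑[ i < k ] δ i x    ≡⟨ sum-cong-≗ (∑-𝟙-∧-≟ true ∘ label π) ⟩
    ∑[ x < n ] 1                   ≡⟨ ∑-1 n ⟩
    n                              ∎
    where
    open ≡-Reasoning
    δ : Fin k → Fin n → ℕ
    δ i x = 𝟙 (does (label π x ≟ᶠ i))

  lowerNeighbour : Fin k → Fin k → Bool
  lowerNeighbour i j = (toℕ j <ᵇ toℕ i) ∧ overlaps π j i

  lowerDegree≡∑ : ∀ i → lowerDegree π i ≡ ∑[ j < k ] 𝟙 (lowerNeighbour i j)
  lowerDegree≡∑ i = length-filter-tabulate (T? ∘ lowerNeighbour i) id

-- Necessity

Admissible : ℕ → List ℤ → Set
Admissible n D = (∃ λ (rest : List ℤ) → D ≡ (+ 0) ∷ rest)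
               × All (λ d → + 0 ≤ℤ d) D
               × Linked (λ x y → y ≤ℤ x +ℤ + 1) D
               × length D + ascentCount D ≤ n

ascentAt : List ℤ → ℕ → Bool
ascentAt (x ∷ y ∷ _)  zero    = does (x <ℤ? y)
ascentAt (_ ∷ y ∷ ys) (suc m) = ascentAt (y ∷ ys) m
ascentAt _            _       = false

ascentCount≡count : ∀ D → ascentCount D ≡ count (ascentAt D) (length D)
ascentCount≡count []           = refl
ascentCount≡count (x ∷ [])     = refl
ascentCount≡count (x ∷ y ∷ ys) = begin
  ascentCount (x ∷ y ∷ ys)                                   ≡⟨ length-filter-∷ ⟩
  𝟙 (does (x <ℤ? y)) + ascentCount (y ∷ ys)                   ≡⟨ cong (_+_ _) (ascentCount≡count (y ∷ ys)) ⟩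
  𝟙 (does (x <ℤ? y)) + count (ascentAt (y ∷ ys)) (suc |ys|)   ≡⟨ count-suc (ascentAt (x ∷ y ∷ ys)) (suc |ys|) ⟨
  count (ascentAt (x ∷ y ∷ ys)) (suc (suc |ys|))              ∎
  where
  open ≡-Reasoning
  |ys| = length ys
  ascent? : (p : ℤ × ℤ) → Dec (proj₁ p <ℤ proj₂ p)
  ascent? p = proj₁ p <ℤ? proj₂ p
  length-filter-∷ : ∀ {ps} → length (filter ascent? ((x , y) ∷ ps)) ≡ 𝟙 (does (x <ℤ? y)) + length (filter ascent? ps)
  length-filter-∷ with does (x <ℤ? y)
  ... | true  = refl
  ... | false = refl

ascentAt-tabulate : ∀ {k} (f : Fin (suc k) → ℤ) (i : Fin (suc k)) → T (ascentAt (tabulate f) (toℕ i)) →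
                    ∃ λ (i' : Fin k) → i ≡ inject₁ i' × f (inject₁ i') <ℤ f (suc i')
ascentAt-tabulate {suc k} f zero    asc with f zero <ℤ? f (suc zero)
... | yes f<f = zero , refl , f<f
ascentAt-tabulate {suc k} f (suc i) asc with ascentAt-tabulate (f ∘ suc) i asc
... | i' , refl , f<f = suc i' , refl , f<f

Linked-tabulate⁺ : ∀ {k} {R : ℤ → ℤ → Set} (f : Fin (suc k) → ℤ) →
                   (∀ (i : Fin k) → R (f (inject₁ i)) (f (suc i))) → Linked R (tabulate f)
Linked-tabulate⁺ {zero}  f h = [-]
Linked-tabulate⁺ {suc k} f h = h zero ∷ Linked-tabulate⁺ (f ∘ suc) (h ∘ suc)

module _ {n k} (π : Partition n (suc k)) where

  lowerDegree-zero : lowerDegree π zero ≡ 0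
  lowerDegree-zero = trans (lowerDegree≡∑ π zero) (sum-replicate-zero (suc k))

  lowerDegree-suc : ∀ (i : Fin k) →
                    lowerDegree π (suc i) ≤ lowerDegree π (inject₁ i) + 𝟙 (overlaps π (inject₁ i) (suc i))
  lowerDegree-suc i = begin
    lowerDegree π (suc i)                                         ≡⟨ lowerDegree≡∑ π (suc i) ⟩
    ∑[ j < suc k ] 𝟙 (lowerNeighbour π (suc i) j)                 ≤⟨ ∑-mono (λ j → 𝟙-≤-+ (lower-of-suc j)) ⟩
    ∑[ j < suc k ] (𝟙 (lowerNeighbour π i' j) + is-i' j)          ≡⟨ ∑-distrib-+ (𝟙 ∘ lowerNeighbour π i') is-i' ⟩
    ∑[ j < suc k ] 𝟙 (lowerNeighbour π i' j) + ∑[ j < suc k ] is-i' j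
                                                                  ≡⟨ cong₂ _+_ (sym (lowerDegree≡∑ π i')) (∑-𝟙-∧-≟ ov i') ⟩
    lowerDegree π i' + 𝟙 ov                                       ∎
    where
    open ≤-Reasoning
    i' = inject₁ i
    ov = overlaps π i' (suc i)
    is-i' : Fin (suc k) → ℕ
    is-i' j = 𝟙 (ov ∧ does (i' ≟ᶠ j))
    i'<1+i : toℕ i' < toℕ (suc i)
    i'<1+i = s≤s (≤-reflexive (toℕ-inject₁ i))
    lower-of-suc : ∀ j → T (lowerNeighbour π (suc i) j) → T (lowerNeighbour π i' j) ⊎ T (ov ∧ does (i' ≟ᶠ j))
    lower-of-suc j lower with Equivalence.to T-∧ lower
    ... | j<ᵇ1+i , ovj with m≤n⇒m<n∨m≡n (subst (toℕ j ≤_) (sym (toℕ-inject₁ i)) (s≤s⁻¹ (<ᵇ⇒< _ _ j<ᵇ1+i)))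
    ...   | inj₁ j<i' = inj₁ (Equivalence.from T-∧ (<⇒<ᵇ j<i' , overlaps-downward π j<i' i'<1+i ovj))
    ...   | inj₂ j≡i' with toℕ-injective {i = j} {j = i'} j≡i'
    ...     | refl = inj₂ (Equivalence.from T-∧ (ovj , subst T (sym (dec-true (j ≟ᶠ j) refl)) _))

  ascent⇒overlaps : ∀ (i : Fin k) → lowerDegree π (inject₁ i) < lowerDegree π (suc i) →
                    T (overlaps π (inject₁ i) (suc i))
  ascent⇒overlaps i ascent with T? (overlaps π (inject₁ i) (suc i))
  ... | yes ov = ov
  ... | no ¬ov = contradiction (≤-trans (lowerDegree-suc i) (≤-reflexive no-jump)) (<⇒≱ ascent)
    where
    no-jump = trans (cong (_+_ (lowerDegree π (inject₁ i))) (𝟙-false ¬ov)) (+-identityʳ _)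

  degrees : List ℤ
  degrees = tabulate (λ i → + lowerDegree π i)

  1+ascent≤|block| : ∀ i → 1 + 𝟙 (ascentAt degrees (toℕ i)) ≤ length (block π i)
  1+ascent≤|block| i with T? (ascentAt degrees (toℕ i))
  ... | no ¬asc = subst (_≤ length (block π i)) (cong suc (sym (𝟙-false ¬asc))) (1≤|block| π i)
  ... | yes asc with ascentAt-tabulate (λ i → + lowerDegree π i) i asc
  ...   | i' , refl , +<+ ascent = subst (_≤ length (block π (inject₁ i'))) (cong suc (sym (𝟙-true asc)))
            (overlaps⇒2≤|block| π (s≤s (≤-reflexive (toℕ-inject₁ i'))) (ascent⇒overlaps i' ascent))

  length+ascentCount≤n : length degrees + ascentCount degrees ≤ n
  length+ascentCount≤n = begin
    length degrees + ascentCount degrees                 ≡⟨ cong₂ _+_ |degrees| ascentCount-degrees ⟩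
    suc k + count (ascentAt degrees) (suc k)             ≡⟨ cong₂ _+_ (∑-1 (suc k)) (∑-𝟙-toℕ (ascentAt degrees) (suc k)) ⟨
    ∑[ i < suc k ] 1 + ∑[ i < suc k ] ascent i           ≡⟨ ∑-distrib-+ {suc k} (λ _ → 1) ascent ⟨
    ∑[ i < suc k ] (1 + ascent i)                        ≤⟨ ∑-mono 1+ascent≤|block| ⟩
    ∑[ i < suc k ] length (block π i)                    ≡⟨ ∑|block|≡n π ⟩
    n                                                    ∎
    where
    open ≤-Reasoning
    ascent : Fin (suc k) → ℕ
    ascent i = 𝟙 (ascentAt degrees (toℕ i))
    |degrees| = length-tabulate (λ i → + lowerDegree π i)
    ascentCount-degrees = trans (ascentCount≡count degrees) (cong (count (ascentAt degrees)) |degrees|)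

  degrees-admissible : Admissible n degrees
  degrees-admissible =
      (tail , cong (λ d → + d ∷ tail) lowerDegree-zero)
    , tabulate⁺ {P = λ d → + 0 ≤ℤ d} {f = λ i → + lowerDegree π i} (λ _ → +≤+ z≤n)
    , Linked-tabulate⁺ (λ i → + lowerDegree π i) (λ i → +≤+ (≤-trans (lowerDegree-suc i) (+-monoʳ-≤ _ (𝟙≤1 _))))
    , length+ascentCount≤n
    where tail = tabulate (λ i → + lowerDegree π (suc i))

D₂-admissible : ∀ {n k} → 1 ≤ n → (π : Partition n k) → Admissible n (D₂ π)
D₂-admissible {suc n} {zero}  _ π with () ← label π zero
D₂-admissible {n}     {suc k} _ π =
  subst (Admissible n) (sym (map-tabulate id (λ i → + lowerDegree π i))) (degrees-admissible π)

-- The construction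

module Construction
  {n k : ℕ} (0<k : 0 < k) (d : ℕ → ℕ) (asc : ℕ → Bool)
  (d-zero : d 0 ≡ 0)
  (d-suc : ∀ m → suc m < k → d (suc m) ≤ d m + 𝟙 (asc m))
  (asc<k : ∀ m → T (asc m) → suc m < k)
  (k+ascents≤n : k + count asc k ≤ n)
  where

  ascentsBefore : ℕ → ℕ
  ascentsBefore = count asc

  ascentsBefore-< : ∀ {j j'} → T (asc j) → j < j' → ascentsBefore j < ascentsBefore j'
  ascentsBefore-< {j} a j<j' = ≤-trans (≤-reflexive (sym jump)) (count-monoʳ asc j<j')
    where jump = trans (cong (_+_ (ascentsBefore j)) (𝟙-true a)) (+-comm (ascentsBefore j) 1)

  d≤ascentsBefore : ∀ {m} → m < k → d m ≤ ascentsBefore m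
  d≤ascentsBefore {zero}  _     = ≤-reflexive d-zero
  d≤ascentsBefore {suc m} 1+m<k =
    ≤-trans (d-suc m 1+m<k) (+-monoˡ-≤ (𝟙 (asc m)) (d≤ascentsBefore (<-trans (n<1+n m) 1+m<k)))

  excess : ℕ → ℕ
  excess m = ascentsBefore m ∸ d m

  excess≤ascentsBefore : ∀ m → excess m ≤ ascentsBefore m
  excess≤ascentsBefore m = m∸n≤m (ascentsBefore m) (d m)

  excess-suc : ∀ m → suc m < k → excess m ≤ excess (suc m)
  excess-suc m 1+m<k = begin
    a ∸ d m                              ≡⟨ [m+n]∸[m+o]≡n∸o (𝟙 (asc m)) a (d m) ⟨
    (𝟙 (asc m) + a) ∸ (𝟙 (asc m) + d m)  ≡⟨ cong₂ _∸_ (+-comm (𝟙 (asc m)) a) (+-comm (𝟙 (asc m)) (d m)) ⟩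
    (a + 𝟙 (asc m)) ∸ (d m + 𝟙 (asc m))  ≤⟨ ∸-monoʳ-≤ (a + 𝟙 (asc m)) (d-suc m 1+m<k) ⟩
    (a + 𝟙 (asc m)) ∸ d (suc m)          ∎
    where
    open ≤-Reasoning
    a = ascentsBefore m

  excess-mono : ∀ {i i'} → i ≤ i' → i' < k → excess i ≤ excess i'
  excess-mono {i' = zero}  z≤n _ = ≤-refl
  excess-mono {i} {suc m} i≤ 1+m<k with i ≟ suc m
  ... | yes refl = ≤-refl
  ... | no i≢    = ≤-trans (excess-mono (s≤s⁻¹ (≤∧≢⇒< i≤ i≢)) (<-trans (n<1+n m) 1+m<k)) (excess-suc m 1+m<k)

  opening : ℕ → ℕ
  opening i = i + excess i

  opening-zero : opening 0 ≡ 0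
  opening-zero = 0∸n≡0 (d 0)

  opening-mono : ∀ {i i'} → i ≤ i' → i' < k → opening i ≤ opening i'
  opening-mono i≤i' i'<k = +-mono-≤ i≤i' (excess-mono i≤i' i'<k)

  opening-strict : ∀ {i i'} → i < i' → i' < k → opening i < opening i'
  opening-strict i<i' i'<k = +-mono-<-≤ i<i' (excess-mono (<⇒≤ i<i') i'<k)

  opening<n : ∀ {i} → i < k → opening i < n
  opening<n {i} i<k = <-≤-trans (+-mono-<-≤ i<k excess≤ascents) k+ascents≤n
    where excess≤ascents = ≤-trans (excess≤ascentsBefore i) (count-monoʳ asc (<⇒≤ i<k))

  openedBeforeSecond : ℕ → ℕ → Bool
  openedBeforeSecond j i = excess i ≤ᵇ ascentsBefore j

  -- The second element of an ascent block j is preceded exactly by the second elements of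
  -- the ascentsBefore j earlier ascent blocks and by the openings of the blocks i with
  -- excess i ≤ ascentsBefore j.
  second : ℕ → ℕ
  second j = ascentsBefore j + count (openedBeforeSecond j) k

  openedBeforeSecond-downClosed : ∀ j → DownClosedBelow k (openedBeforeSecond j)
  openedBeforeSecond-downClosed j {i} {i'} i≤i' i'<k e≤a =
    ≤⇒≤ᵇ (≤-trans (excess-mono i≤i' i'<k) (≤ᵇ⇒≤ (excess i') (ascentsBefore j) e≤a))

  opening<second : ∀ {i} j → i < k → excess i ≤ ascentsBefore j → opening i < second j
  opening<second {i} j i<k e≤a = subst (opening i <_) (+-comm (count (openedBeforeSecond j) k) (ascentsBefore j))
    (+-mono-<-≤ (<count-trueAt (openedBeforeSecond-downClosed j) i<k (≤⇒≤ᵇ e≤a)) e≤a)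

  second<opening : ∀ {i} j → i < k → ascentsBefore j < excess i → second j < opening i
  second<opening {i} j i<k a<e = subst (second j <_) (+-comm (excess i) i)
    (+-mono-<-≤ a<e (count≤-falseAt k (openedBeforeSecond-downClosed j) i<k not-opened))
    where not-opened = <⇒≱ a<e ∘ ≤ᵇ⇒≤ (excess i) (ascentsBefore j)

  opening≢second : ∀ {i} j → i < k → opening i ≢ second j
  opening≢second {i} j i<k eq with excess i ≤? ascentsBefore j
  ... | yes e≤a = <-irrefl eq (opening<second j i<k e≤a)
  ... | no  e≰a = <-irrefl (sym eq) (second<opening j i<k (≰⇒> e≰a))

  second-strict : ∀ {j j'} → T (asc j) → j < j' → second j < second j'
  second-strict {j} {j'} a j<j' = +-mono-<-≤ a<a' (count-mono k opened-later)
    where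
    a<a' = ascentsBefore-< a j<j'
    opened-later : ∀ i → i < k → T (openedBeforeSecond j i) → T (openedBeforeSecond j' i)
    opened-later i _ e≤a = ≤⇒≤ᵇ (≤-trans (≤ᵇ⇒≤ (excess i) (ascentsBefore j) e≤a) (<⇒≤ a<a'))

  second-injective : ∀ {j j'} → T (asc j) → T (asc j') → second j ≡ second j' → j ≡ j'
  second-injective {j} {j'} a a' eq with <-cmp j j'
  ... | tri< j<j' _ _ = contradiction eq (<⇒≢ (second-strict a j<j'))
  ... | tri≈ _ j≡j' _ = j≡j'
  ... | tri> _ _ j>j' = contradiction (sym eq) (<⇒≢ (second-strict a' j>j'))

  second<n : ∀ {j} → T (asc j) → second j < n
  second<n {j} a = <-≤-trans (subst (_< k + count asc k) (+-comm _ (ascentsBefore j)) second<k+ascents) k+ascents≤n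
    where second<k+ascents = +-mono-≤-< (count≤ _ k) (ascentsBefore-< a (<-trans (n<1+n j) (asc<k j a)))

  openedBy : ℕ → ℕ → Bool
  openedBy x i = opening i ≤ᵇ x

  openedBy-downClosed : ∀ x → DownClosedBelow k (openedBy x)
  openedBy-downClosed x {i} {i'} i≤i' i'<k o≤x = ≤⇒≤ᵇ (≤-trans (opening-mono i≤i' i'<k) (≤ᵇ⇒≤ (opening i') x o≤x))

  lastOpened : ℕ → ℕ
  lastOpened x = pred (count (openedBy x) k)

  openedBy-zero : ∀ x → T (openedBy x 0)
  openedBy-zero x = ≤⇒≤ᵇ (subst (_≤ x) (sym opening-zero) z≤n)

  lastOpened<count : ∀ x → lastOpened x < count (openedBy x) k
  lastOpened<count x with count (openedBy x) k | <count-trueAt (openedBy-downClosed x) 0<k (openedBy-zero x)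
  ... | suc c | _ = n<1+n c

  lastOpened<k : ∀ x → lastOpened x < k
  lastOpened<k x = <-≤-trans (lastOpened<count x) (count≤ _ k)

  opening-lastOpened : ∀ x → opening (lastOpened x) ≤ x
  opening-lastOpened x with T? (openedBy x (lastOpened x))
  ... | yes o≤x = ≤ᵇ⇒≤ _ x o≤x
  ... | no  o≰x = contradiction (count≤-falseAt k (openedBy-downClosed x) (lastOpened<k x) o≰x) (<⇒≱ (lastOpened<count x))

  <opening-afterLast : ∀ x {i} → lastOpened x < i → i < k → x < opening i
  <opening-afterLast x {i} ℓ<i i<k = ≰⇒> λ o≤x →
    <⇒≱ ℓ<i (<⇒≤pred (<count-trueAt (openedBy-downClosed x) i<k (≤⇒≤ᵇ o≤x)))

  IsSecond : ℕ → Set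
  IsSecond x = ∃ λ (j : Fin k) → T (asc (toℕ j)) × second (toℕ j) ≡ x

  isSecond? : ∀ x → Dec (IsSecond x)
  isSecond? x = any? (λ j → T? (asc (toℕ j)) ×-dec (second (toℕ j) ≟ x))

  blockOf : Fin n → Fin k
  blockOf x with isSecond? (toℕ x)
  ... | yes (j , _) = j
  ... | no  _       = fromℕ< (lastOpened<k (toℕ x))

  blockOf-spec : ∀ x {j} → blockOf x ≡ j →
                 (T (asc (toℕ j)) × second (toℕ j) ≡ toℕ x)
                 ⊎ (opening (toℕ j) ≤ toℕ x × ∀ {i} → toℕ j < i → i < k → toℕ x < opening i)
  blockOf-spec x refl with isSecond? (toℕ x)
  ... | yes (_ , a , s) = inj₁ (a , s)
  ... | no  _           = inj₂ ( subst (λ ℓ → opening ℓ ≤ toℕ x) (sym ℓ≡) (opening-lastOpened (toℕ x))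
                               , λ ℓ<i → <opening-afterLast (toℕ x) (subst (_< _) ℓ≡ ℓ<i))
    where ℓ≡ = toℕ-fromℕ< (lastOpened<k (toℕ x))

  opening≤ : ∀ x {j} → blockOf x ≡ j → opening (toℕ j) ≤ toℕ x
  opening≤ x {j} x∈j with blockOf-spec x x∈j
  ... | inj₁ (_ , s)   = ≤-trans (<⇒≤ (opening<second (toℕ j) (toℕ<n j) (excess≤ascentsBefore (toℕ j)))) (≤-reflexive s)
  ... | inj₂ (o≤x , _) = o≤x

  openingAt : Fin k → Fin n
  openingAt i = fromℕ< (opening<n (toℕ<n i))

  toℕ-openingAt : ∀ i → toℕ (openingAt i) ≡ opening (toℕ i)
  toℕ-openingAt i = toℕ-fromℕ< (opening<n (toℕ<n i))

  secondAt : ∀ {j : Fin k} → T (asc (toℕ j)) → Fin n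
  secondAt a = fromℕ< (second<n a)

  blockOf-opening : ∀ i → blockOf (openingAt i) ≡ i
  blockOf-opening i = block≡i refl
    where
    block≡i : ∀ {j} → blockOf (openingAt i) ≡ j → j ≡ i
    block≡i {j} x∈j with blockOf-spec (openingAt i) x∈j
    ... | inj₁ (_ , s) = contradiction (trans (sym (toℕ-openingAt i)) (sym s)) (opening≢second (toℕ j) (toℕ<n i))
    ... | inj₂ (oj≤x , x<later) with <-cmp (toℕ j) (toℕ i)
    ...   | tri< j<i _ _ = contradiction (x<later j<i (toℕ<n i)) (<-irrefl (toℕ-openingAt i))
    ...   | tri≈ _ j≡i _ = toℕ-injective j≡i
    ...   | tri> _ _ i<j = contradiction (<-≤-trans (opening-strict i<j (toℕ<n j)) oj≤x) (<-irrefl (sym (toℕ-openingAt i)))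

  blockOf-second : ∀ {j} (a : T (asc (toℕ j))) → blockOf (secondAt a) ≡ j
  blockOf-second {j} a with isSecond? (toℕ (secondAt a))
  ... | yes (j' , a' , s) = toℕ-injective (second-injective a' a (trans s (toℕ-fromℕ< (second<n a))))
  ... | no  ¬second       = contradiction (j , a , sym (toℕ-fromℕ< (second<n a))) ¬second

  partition : Partition n k
  partition = record
    { label    = blockOf
    ; nonempty = λ i → openingAt i , blockOf-opening i
    ; minOrder = λ i j i<j y y∈j → openingAt i , blockOf-opening i
                   , subst (_< toℕ y) (sym (toℕ-openingAt i)) (<-≤-trans (opening-strict i<j (toℕ<n j)) (opening≤ y y∈j))
    }

  overlaps-partition⁻ : ∀ {j i : Fin k} → toℕ j < toℕ i → T (overlaps partition j i) →
                        T (asc (toℕ j)) × excess (toℕ i) ≤ ascentsBefore (toℕ j)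
  overlaps-partition⁻ {j} {i} j<i ov with overlaps⁻ partition j<i ov
  ... | x , y , x∈j , y∈i , y<x with blockOf-spec x x∈j
  ...   | inj₂ (_ , x<later) = contradiction (<⇒≤ (≤-<-trans (opening≤ y y∈i) y<x)) (<⇒≱ (x<later j<i (toℕ<n i)))
  ...   | inj₁ (a , s) with excess (toℕ i) ≤? ascentsBefore (toℕ j)
  ...     | yes e≤a = a , e≤a
  ...     | no  e≰a = contradiction (≤-<-trans (opening≤ y y∈i) (<-≤-trans y<x (≤-reflexive (sym s))))
                        (<-asym (second<opening (toℕ j) (toℕ<n i) (≰⇒> e≰a)))

  overlaps-partition⁺ : ∀ {j i : Fin k} → toℕ j < toℕ i → T (asc (toℕ j)) → excess (toℕ i) ≤ ascentsBefore (toℕ j) →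
                        T (overlaps partition j i)
  overlaps-partition⁺ {j} {i} j<i a e≤a =
    overlaps⁺ partition j<i (blockOf-second a) (blockOf-opening i)
      (subst₂ _<_ (sym (toℕ-openingAt i)) (sym (toℕ-fromℕ< (second<n a))) (opening<second (toℕ j) (toℕ<n i) e≤a))

  lowerDegree-partition : ∀ i → lowerDegree partition i ≡ d (toℕ i)
  lowerDegree-partition i = begin
    lowerDegree partition i                                   ≡⟨ lowerDegree≡∑ partition i ⟩
    ∑[ j < k ] 𝟙 (lowerNeighbour partition i j)               ≡⟨ sum-cong-≗ (cong 𝟙 ∘ lowerNeighbour≡) ⟩
    ∑[ j < k ] 𝟙 ((toℕ j <ᵇ t) ∧ lateAscent (toℕ j))          ≡⟨ ∑-𝟙-toℕ (λ m → (m <ᵇ t) ∧ lateAscent m) k ⟩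
    count (λ m → (m <ᵇ t) ∧ lateAscent m) k                   ≡⟨ count-below lateAscent (<⇒≤ (toℕ<n i)) ⟩
    count lateAscent t                                        ≡⟨ count-∧-≤ᵇ-count asc (excess t) t ⟩
    ascentsBefore t ∸ (ascentsBefore t ∸ d t)                 ≡⟨ m∸[m∸n]≡n (d≤ascentsBefore (toℕ<n i)) ⟩
    d t                                                       ∎
    where
    open ≡-Reasoning
    t = toℕ i
    lateAscent : ℕ → Bool
    lateAscent m = asc m ∧ (excess t ≤ᵇ ascentsBefore m)
    lowerNeighbour≡ : ∀ j → lowerNeighbour partition i j ≡ (toℕ j <ᵇ t) ∧ lateAscent (toℕ j)
    lowerNeighbour≡ j with toℕ j <ᵇ t | <ᵇ-reflects-< (toℕ j) t
    ... | false | _       = refl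
    ... | true  | ofʸ j<i = T-ext
      (λ ov → let a , e≤a = overlaps-partition⁻ j<i ov in Equivalence.from T-∧ (a , ≤⇒≤ᵇ e≤a))
      (λ late → let a , e≤a = Equivalence.to T-∧ late in overlaps-partition⁺ j<i a (≤ᵇ⇒≤ (excess t) _ e≤a))

-- Sufficiency

absAt : List ℤ → ℕ → ℕ
absAt []       _       = 0
absAt (x ∷ _)  zero    = ∣ x ∣
absAt (_ ∷ xs) (suc m) = absAt xs m

absAt-suc≤ : ∀ D → All (λ d → + 0 ≤ℤ d) D → Linked (λ x y → y ≤ℤ x +ℤ + 1) D →
             ∀ m → suc m < length D → absAt D (suc m) ≤ absAt D m + 𝟙 (ascentAt D m)
absAt-suc≤ (+ a ∷ + b ∷ _) (+≤+ _ ∷ +≤+ _ ∷ _) (b≤a+1 ∷ _) zero _ with a <ᵇ b | <ᵇ-reflects-< a b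
... | true  | _       = drop‿+≤+ b≤a+1
... | false | ofⁿ a≮b = ≤-trans (≮⇒≥ a≮b) (≤-reflexive (sym (+-identityʳ a)))
absAt-suc≤ (_ ∷ -[1+ _ ] ∷ _) (_ ∷ () ∷ _) _ zero _
absAt-suc≤ (_ ∷ y ∷ ys) (_ ∷ nonneg) (_ ∷ linked) (suc m) (s≤s 2+m<) = absAt-suc≤ (y ∷ ys) nonneg linked m 2+m<
absAt-suc≤ (_ ∷ [])     _            _            _       (s≤s ())

ascentAt<length : ∀ D m → T (ascentAt D m) → suc m < length D
ascentAt<length (_ ∷ _ ∷ _)  zero    _   = s≤s (s≤s z≤n)
ascentAt<length (_ ∷ y ∷ ys) (suc m) asc = s≤s (ascentAt<length (y ∷ ys) m asc)

+absAt≡lookup : ∀ D → All (λ d → + 0 ≤ℤ d) D → ∀ i → + absAt D (toℕ i) ≡ lookup D i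
+absAt≡lookup (+ _ ∷ _) (+≤+ _ ∷ _)  zero    = refl
+absAt≡lookup (_ ∷ xs)  (_ ∷ nonneg) (suc i) = +absAt≡lookup xs nonneg i

admissible⇒D₂ : ∀ {n} D → Admissible n D → ∃ λ (π : Partition n (length D)) → D₂ π ≡ D
admissible⇒D₂ {n} D ((rest , refl) , nonneg , linked , size) = partition , D₂-partition
  where
  open Construction {n} {length D} (s≤s z≤n) (absAt D) (ascentAt D) refl (absAt-suc≤ D nonneg linked)
         (ascentAt<length D) (subst (λ c → length D + c ≤ n) (ascentCount≡count D) size)
  open ≡-Reasoning
  D₂-partition : D₂ partition ≡ D
  D₂-partition = begin
    D₂ partition                                ≡⟨ map-tabulate id (λ i → + lowerDegree partition i) ⟩
    tabulate (λ i → + lowerDegree partition i)  ≡⟨ tabulate-cong (λ i → trans (cong +_ (lowerDegree-partition i)) (+absAt≡lookup D nonneg i)) ⟩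
    tabulate (lookup D)                         ≡⟨ tabulate-lookup D ⟩
    D                                           ∎

proposition9p4 : ∀ (n : ℕ) → 1 ≤ n → ∀ (D : List ℤ) →
    (∃ λ (π : Partition n (length D)) → D₂ π ≡ D)
    ⇔ ((∃ λ (rest : List ℤ) → D ≡ (+ 0) ∷ rest)
       × All (λ d → + 0 ≤ℤ d) D
       × Linked (λ x y → y ≤ℤ x +ℤ + 1) D
       × length D + ascentCount D ≤ n)
proposition9p4 n 1≤n D = mk⇔
  (λ (π , D₂π≡D) → subst (Admissible n) D₂π≡D (D₂-admissible 1≤n π))
  (admissible⇒D₂ D)
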